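{- Let $i, j$ be integers. There exists $n \geq 0$ with $s(n) = i$ and $s(n+1) = j$ if and only if at least one of the following holds: (a) $i > 0$ and $-i \leq j \leq i-1$; (b) $j \geq 1$, $1-j \leq i \leq j+1$, and $i \not\equiv j \pmod 2$; (c) $j \leq -2$, $j+2 \leq i \leq -j-2$, and $i \equiv j \pmod 2$.
   Context: The infinity series $(s(n))_{n \geq 0}$ is the integer sequence defined by $s(0)=0$, $s(2n) = -s(n)$ for $n \geq 1$, and $s(2n+1) = s(n)+1$ for $n \geq 0$. -}

module Defs where

open import Data.Nat using (ℕ; zero; suc; _/_; _%_)
open import Data.Integer using (ℤ; +_; -_; _+_)

-- Auxiliary: s-fuel k n computes s(n) by the defining recursion
--   s(0) = 0,  s(2m) = - s(m) (m ≥ 1),  s(2m+1) = s(m) + 1,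
-- using at most k recursive steps; with k ≥ n the fuel never runs out
-- (n / 2 < n for n ≥ 1), so s n = s-fuel n n is the infinity series.
s-fuel : ℕ → ℕ → ℤ
s-fuel zero    n       = + 0
s-fuel (suc k) zero    = + 0
s-fuel (suc k) (suc n) with suc n % 2
... | zero  = - s-fuel k (suc n / 2)
... | suc _ = s-fuel k (suc n / 2) + + 1

s : ℕ → ℤ
s n = s-fuel n n

-- Since s (1 + 2m) = s m + 1 and s (2 + 2m) = - s (1 + m), the pair (s n , s (1 + n)) is
-- (- a , a + 1) with a = s (1 + m) when n = 2 + 2m (or n = 0), and the image of the pair at m
-- under (i , j) ↦ (i + 1 , - j) when n = 1 + 2m.  As s (1 + m) takes every integer value, the
-- realised pairs are exactly the orbits of the (- a , a + 1) under this map; an orbit point is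
-- (1 + 2t - j , j) or (j + 2 + 2t , j), i.e. i + j is odd and positive or i - j is even and
-- positive, and splitting on the parity of i - j turns this into the conditions (a), (b), (c).
module Submission where

open import Data.Empty using (⊥-elim)
open import Data.Integer using (ℤ; +_; -[1+_]; -_; _+_; _-_; _*_; _≤_; _<_; _≤?_; +≤+; ∣_∣)
open import Data.Integer.Divisibility using (_∣_)
import Data.Integer.Divisibility.Signed as Signed
import Data.Integer.DivMod as ℤ
open import Data.Integer.Properties
  using (≤-trans; ≤-reflexive; +-identityʳ; +-identityˡ; +-monoʳ-≤; +-mono-≤; i≤j+i; neg-mono-≤; neg-involutive;
         ≰⇒>; i<j⇒suc[i]≤j; suc[i]≤j⇒i<j; i≤j⇒0≤j-i; 0≤i⇒+∣i∣≡i)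
open import Data.Integer.Tactic.RingSolver using (solve; solve-∀)
open import Data.List using (_∷_; [])
open import Data.Nat as ℕ using (ℕ; zero; suc; z≤n; s≤s)
open import Data.Nat.DivMod using (m/n<m; [m+kn]%n≡m%n; m*n%n≡0; m*n/n≡m; +-distrib-/-∣ʳ)
open import Data.Nat.Divisibility using (divides-refl; ∣1⇒≡1)
open import Data.Nat.Induction using (<-rec)
import Data.Nat.Properties as ℕₚ
open import Data.Product using (Σ; _×_; _,_)
open import Data.Sum using (_⊎_; inj₁; inj₂)
open import Function.Bundles using (_⇔_; mk⇔)
open import Relation.Nullary using (¬_; yes; no)
open import Relation.Binary.PropositionalEquality using (_≡_; refl; sym; trans; cong; cong₂; subst; subst₂; module ≡-Reasoning)

open import Defs

digit : ℕ → ℤ → ℤ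
digit zero    x = - x
digit (suc _) x = x + + 1

s-fuel-suc : ∀ k n → s-fuel (suc k) (suc n) ≡ digit (suc n ℕ.% 2) (s-fuel k (suc n ℕ./ 2))
s-fuel-suc k n with suc n ℕ.% 2
... | zero  = refl
... | suc _ = refl

s-fuel-zero : ∀ k → s-fuel k 0 ≡ + 0
s-fuel-zero zero    = refl
s-fuel-zero (suc k) = refl

[1+n]/2≤n : ∀ n → suc n ℕ./ 2 ℕ.≤ n
[1+n]/2≤n n = ℕ.s≤s⁻¹ (m/n<m (suc n) 2 (s≤s (s≤s z≤n)))

s-fuel-stable : ∀ {k k′} n → n ℕ.≤ k → n ℕ.≤ k′ → s-fuel k n ≡ s-fuel k′ n
s-fuel-stable {k} {k′} zero _ _ = trans (s-fuel-zero k) (sym (s-fuel-zero k′))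
s-fuel-stable {suc k} {suc k′} (suc n) (s≤s n≤k) (s≤s n≤k′) = begin
  s-fuel (suc k) (suc n)                        ≡⟨ s-fuel-suc k n ⟩
  digit (suc n ℕ.% 2) (s-fuel k (suc n ℕ./ 2))  ≡⟨ cong (digit (suc n ℕ.% 2)) (s-fuel-stable _ n/2≤k n/2≤k′) ⟩
  digit (suc n ℕ.% 2) (s-fuel k′ (suc n ℕ./ 2)) ≡⟨ sym (s-fuel-suc k′ n) ⟩
  s-fuel (suc k′) (suc n)                       ∎
  where
  open ≡-Reasoning
  n/2≤k : suc n ℕ./ 2 ℕ.≤ k
  n/2≤k = ℕₚ.≤-trans ([1+n]/2≤n n) n≤k
  n/2≤k′ : suc n ℕ./ 2 ℕ.≤ k′
  n/2≤k′ = ℕₚ.≤-trans ([1+n]/2≤n n) n≤k′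

s-fuel≡s : ∀ {k} n → n ℕ.≤ k → s-fuel k n ≡ s n
s-fuel≡s n n≤k = s-fuel-stable n n≤k ℕₚ.≤-refl

s[1+m*2]≡s[m]+1 : ∀ m → s (suc (m ℕ.* 2)) ≡ s m + + 1
s[1+m*2]≡s[m]+1 m = begin
  s (suc (m ℕ.* 2))
    ≡⟨ s-fuel-suc (m ℕ.* 2) (m ℕ.* 2) ⟩
  digit (suc (m ℕ.* 2) ℕ.% 2) (s-fuel (m ℕ.* 2) (suc (m ℕ.* 2) ℕ./ 2))
    ≡⟨ cong₂ digit ([m+kn]%n≡m%n 1 m 2) (cong (s-fuel (m ℕ.* 2)) [1+m*2]/2≡m) ⟩
  s-fuel (m ℕ.* 2) m + + 1
    ≡⟨ cong (_+ + 1) (s-fuel≡s m (ℕₚ.m≤m*n m 2)) ⟩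
  s m + + 1
    ∎
  where
  open ≡-Reasoning
  [1+m*2]/2≡m : suc (m ℕ.* 2) ℕ./ 2 ≡ m
  [1+m*2]/2≡m = trans (+-distrib-/-∣ʳ 1 {d = 2} (divides-refl m)) (m*n/n≡m m 2)

s[[1+m]*2]≡-s[1+m] : ∀ m → s (suc m ℕ.* 2) ≡ - s (suc m)
s[[1+m]*2]≡-s[1+m] m = begin
  s (suc m ℕ.* 2)
    ≡⟨ s-fuel-suc (suc (m ℕ.* 2)) (suc (m ℕ.* 2)) ⟩
  digit (suc m ℕ.* 2 ℕ.% 2) (s-fuel (suc (m ℕ.* 2)) (suc m ℕ.* 2 ℕ./ 2))
    ≡⟨ cong₂ digit (m*n%n≡0 (suc m) 2) (cong (s-fuel (suc (m ℕ.* 2))) (m*n/n≡m (suc m) 2)) ⟩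
  - s-fuel (suc (m ℕ.* 2)) (suc m)
    ≡⟨ cong -_ (s-fuel≡s (suc m) (s≤s (ℕₚ.m≤m*n m 2))) ⟩
  - s (suc m)
    ∎
  where open ≡-Reasoning

data ParityView : ℕ → Set where
  zero : ParityView 0
  odd  : ∀ m → ParityView (suc (m ℕ.* 2))
  even : ∀ m → ParityView (suc m ℕ.* 2)

parityView : ∀ n → ParityView n
parityView zero = zero
parityView (suc n) with parityView n
... | zero   = odd 0
... | odd m  = even m
... | even m = odd (suc m)

data Consecutive : ℤ → ℤ → Set where
  neg-suc : ∀ a → Consecutive (- a) (a + + 1)
  suc-neg : ∀ {i j} → Consecutive i j → Consecutive (i + + 1) (- j)

s-consecutive : ∀ n → Consecutive (s n) (s (suc n))
s-consecutive = <-rec _ consecutive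
  where
  consecutive : ∀ n → (∀ {m} → m ℕ.< n → Consecutive (s m) (s (suc m))) → Consecutive (s n) (s (suc n))
  consecutive n rec with parityView n
  ... | zero = neg-suc (+ 0)
  ... | odd m rewrite s[1+m*2]≡s[m]+1 m | s[[1+m]*2]≡-s[1+m] m = suc-neg (rec (s≤s (ℕₚ.m≤m*n m 2)))
  ... | even m rewrite s[[1+m]*2]≡-s[1+m] m | s[1+m*2]≡s[m]+1 (suc m) = neg-suc (s (suc m))

-- 2 ^ b - 1, whose binary expansion is b ones
ones : ℕ → ℕ
ones zero    = 0
ones (suc b) = suc (ones b ℕ.* 2)

s-ones : ∀ b → s (ones b) ≡ + b
s-ones zero    = refl
s-ones (suc b) = begin
  s (suc (ones b ℕ.* 2)) ≡⟨ s[1+m*2]≡s[m]+1 (ones b) ⟩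
  s (ones b) + + 1       ≡⟨ cong (_+ + 1) (s-ones b) ⟩
  + (b ℕ.+ 1)            ≡⟨ cong +_ (ℕₚ.+-comm b 1) ⟩
  + suc b                ∎
  where open ≡-Reasoning

s-suc-surjective : ∀ a → Σ ℕ λ m → s (suc m) ≡ a
s-suc-surjective (+ zero)  = 4 , refl
s-suc-surjective (+ suc b) = ones b ℕ.* 2 , s-ones (suc b)
s-suc-surjective -[1+ b ]  =
  suc (ones b ℕ.* 2 ℕ.* 2) , trans (s[[1+m]*2]≡-s[1+m] (ones b ℕ.* 2)) (cong -_ (s-ones (suc b)))

consecutive-realised : ∀ {i j} → Consecutive i j → Σ ℕ λ n → s n ≡ i × s (suc n) ≡ j
consecutive-realised (neg-suc a) with s-suc-surjective a
... | m , refl = suc m ℕ.* 2 , s[[1+m]*2]≡-s[1+m] m , s[1+m*2]≡s[m]+1 (suc m)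
consecutive-realised (suc-neg c) with consecutive-realised c
... | n , refl , refl = suc (n ℕ.* 2) , s[1+m*2]≡s[m]+1 n , s[[1+m]*2]≡-s[1+m] n

OddSumOrEvenGap : ℤ → ℤ → Set
OddSumOrEvenGap i j = (Σ ℕ λ t → i ≡ + 1 + (+ t + + t) - j) ⊎ (Σ ℕ λ t → i ≡ j + + 2 + (+ t + + t))

odd-sum-or-even-gap-suc-neg : ∀ {i j} → OddSumOrEvenGap i j → OddSumOrEvenGap (i + + 1) (- j)
odd-sum-or-even-gap-suc-neg {j = j} (inj₁ (t , refl)) = inj₂ (t , shift j (+ t))
  where
  shift : ∀ j t → + 1 + (t + t) - j + + 1 ≡ - j + + 2 + (t + t)
  shift = solve-∀
odd-sum-or-even-gap-suc-neg {j = j} (inj₂ (t , refl)) = inj₁ (suc t , shift j (+ t))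
  where
  shift : ∀ j t → j + + 2 + (t + t) + + 1 ≡ + 1 + ((+ 1 + t) + (+ 1 + t)) - - j
  shift = solve-∀

consecutive⇒odd-sum-or-even-gap : ∀ {i j} → Consecutive i j → OddSumOrEvenGap i j
consecutive⇒odd-sum-or-even-gap (neg-suc a) = inj₁ (0 , solve (a ∷ []))
consecutive⇒odd-sum-or-even-gap (suc-neg {j = j} c) =
  odd-sum-or-even-gap-suc-neg {j = j} (consecutive⇒odd-sum-or-even-gap c)

odd-sum-consecutive  : ∀ t j → Consecutive (+ 1 + (+ t + + t) - j) j
even-gap-consecutive : ∀ t j → Consecutive (j + + 2 + (+ t + + t)) j

odd-sum-consecutive zero j = subst₂ Consecutive (neg-pred j) (pred-suc j) (neg-suc (j - + 1))
  where
  neg-pred : ∀ j → - (j - + 1) ≡ + 1 + (+ 0 + + 0) - j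
  neg-pred = solve-∀
  pred-suc : ∀ j → j - + 1 + + 1 ≡ j
  pred-suc = solve-∀
odd-sum-consecutive (suc t) j =
  subst₂ Consecutive (shift j (+ t)) (neg-involutive j) (suc-neg (even-gap-consecutive t (- j)))
  where
  shift : ∀ j t → - j + + 2 + (t + t) + + 1 ≡ + 1 + ((+ 1 + t) + (+ 1 + t)) - j
  shift = solve-∀

even-gap-consecutive t j =
  subst₂ Consecutive (shift j (+ t)) (neg-involutive j) (suc-neg (odd-sum-consecutive t (- j)))
  where
  shift : ∀ j t → + 1 + (t + t) - - j + + 1 ≡ j + + 2 + (t + t)
  shift = solve-∀

odd-sum-or-even-gap⇒consecutive : ∀ {i j} → OddSumOrEvenGap i j → Consecutive i j
odd-sum-or-even-gap⇒consecutive (inj₁ (t , refl)) = odd-sum-consecutive t _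
odd-sum-or-even-gap⇒consecutive (inj₂ (t , refl)) = even-gap-consecutive t _

y+y≡y*2 : ∀ y → y + y ≡ y * + 2
y+y≡y*2 = solve-∀

even-or-odd : ∀ x → (Σ ℤ λ y → x ≡ y + y) ⊎ (Σ ℤ λ y → x ≡ + 1 + (y + y))
even-or-odd x with x ℤ.% + 2 | ℤ.n%d<d x (+ 2) | ℤ.a≡a%n+[a/n]*n x (+ 2)
... | 0           | _             | x≡r+q*2 =
  inj₁ (x ℤ./ + 2 , trans x≡r+q*2 (trans (+-identityˡ _) (sym (y+y≡y*2 (x ℤ./ + 2)))))
... | 1           | _             | x≡r+q*2 =
  inj₂ (x ℤ./ + 2 , trans x≡r+q*2 (cong (_+_ (+ 1)) (sym (y+y≡y*2 (x ℤ./ + 2)))))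
... | suc (suc _) | s≤s (s≤s ()) | _

2∣y+y : ∀ y → + 2 ∣ y + y
2∣y+y y = Signed.∣⇒∣ᵤ (Signed.divides y (y+y≡y*2 y))

2∤1+[y+y] : ∀ y → ¬ (+ 2 ∣ + 1 + (y + y))
2∤1+[y+y] y 2∣1+[y+y] with ∣1⇒≡1 (Signed.∣⇒∣ᵤ 2∣1)
  where
  2∣1 : + 2 Signed.∣ + 1
  2∣1 = Signed.∣m+n∣n⇒∣m (Signed.∣ᵤ⇒∣ {i = + 1 + (y + y)} 2∣1+[y+y]) (Signed.∣ᵤ⇒∣ {i = y + y} (2∣y+y y))
... | ()

≤-by-slack : ∀ {a b} c → + 0 ≤ c → b ≡ a + c → a ≤ b
≤-by-slack {a} c 0≤c refl = ≤-trans (≤-reflexive (sym (+-identityʳ a))) (+-monoʳ-≤ a 0≤c)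

0<-by-slack : ∀ {b} c → + 0 ≤ c → b ≡ + 1 + c → + 0 < b
0<-by-slack c 0≤c b≡1+c = suc[i]≤j⇒i<j (≤-by-slack c 0≤c b≡1+c)

0≤+ : ∀ n → + 0 ≤ + n
0≤+ _ = +≤+ z≤n

0≤1+[y+y]⇒0≤y : ∀ y → + 0 ≤ + 1 + (y + y) → + 0 ≤ y
0≤1+[y+y]⇒0≤y (+ n)    _ = 0≤+ n
0≤1+[y+y]⇒0≤y -[1+ n ] ()

Conditions : ℤ → ℤ → Set
Conditions i j =
  (+ 0 < i × - i ≤ j × j ≤ i - + 1)
  ⊎ (+ 1 ≤ j × + 1 - j ≤ i × i ≤ j + + 1 × ¬ (+ 2 ∣ i - j))
  ⊎ (j ≤ - + 2 × j + + 2 ≤ i × i ≤ - j - + 2 × + 2 ∣ i - j)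

odd-sum-conditions : ∀ t j → + 0 ≤ t → Conditions (+ 1 + (t + t) - j) j
odd-sum-conditions t j 0≤t with j ≤? t
... | yes j≤t = inj₁
  ( 0<-by-slack (t + (t - j)) (+-mono-≤ 0≤t 0≤t-j) (solve (t ∷ j ∷ []))
  , ≤-by-slack (+ 1 + (t + t)) (+-mono-≤ (0≤+ 1) (+-mono-≤ 0≤t 0≤t)) (solve (t ∷ j ∷ []))
  , ≤-by-slack ((t - j) + (t - j)) (+-mono-≤ 0≤t-j 0≤t-j) (solve (t ∷ j ∷ [])) )
  where
  0≤t-j : + 0 ≤ t - j
  0≤t-j = i≤j⇒0≤j-i j≤t
... | no j≰t = inj₂ (inj₁
  ( ≤-by-slack (t + (j - (+ 1 + t))) (+-mono-≤ 0≤t 0≤j-t-1) (solve (t ∷ j ∷ []))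
  , ≤-by-slack (t + t) (+-mono-≤ 0≤t 0≤t) (solve (t ∷ j ∷ []))
  , ≤-by-slack ((j - t) + (j - t)) (+-mono-≤ 0≤j-t 0≤j-t) (solve (t ∷ j ∷ []))
  , λ 2∣i-j → 2∤1+[y+y] (t - j) (subst (+ 2 ∣_) i-j≡1+2[t-j] 2∣i-j) ))
  where
  i-j≡1+2[t-j] : + 1 + (t + t) - j - j ≡ + 1 + ((t - j) + (t - j))
  i-j≡1+2[t-j] = solve (t ∷ j ∷ [])
  1+t≤j : + 1 + t ≤ j
  1+t≤j = i<j⇒suc[i]≤j (≰⇒> j≰t)
  0≤j-t-1 : + 0 ≤ j - (+ 1 + t)
  0≤j-t-1 = i≤j⇒0≤j-i 1+t≤j
  0≤j-t : + 0 ≤ j - t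
  0≤j-t = i≤j⇒0≤j-i (≤-trans (i≤j+i t (+ 1)) 1+t≤j)

even-gap-conditions : ∀ t j → + 0 ≤ t → Conditions (j + + 2 + (t + t)) j
even-gap-conditions t j 0≤t with j + + 2 + t ≤? + 0
... | yes j+2+t≤0 = inj₂ (inj₂
  ( ≤-by-slack (- (j + + 2 + t) + t) (+-mono-≤ 0≤-[j+2+t] 0≤t) (solve (t ∷ j ∷ []))
  , ≤-by-slack (t + t) (+-mono-≤ 0≤t 0≤t) (solve (t ∷ j ∷ []))
  , ≤-by-slack (- (j + + 2 + t) + - (j + + 2 + t)) (+-mono-≤ 0≤-[j+2+t] 0≤-[j+2+t]) (solve (t ∷ j ∷ []))
  , subst (+ 2 ∣_) (sym i-j≡2[1+t]) (2∣y+y (+ 1 + t)) ))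
  where
  0≤-[j+2+t] : + 0 ≤ - (j + + 2 + t)
  0≤-[j+2+t] = neg-mono-≤ j+2+t≤0
  i-j≡2[1+t] : j + + 2 + (t + t) - j ≡ (+ 1 + t) + (+ 1 + t)
  i-j≡2[1+t] = solve (t ∷ j ∷ [])
... | no j+2+t≰0 = inj₁
  ( 0<-by-slack ((j + + 2 + t - + 1) + t) (+-mono-≤ 0≤j+2+t-1 0≤t) (solve (t ∷ j ∷ []))
  , ≤-by-slack ((j + + 2 + t - + 1) + (j + + 2 + t - + 1)) (+-mono-≤ 0≤j+2+t-1 0≤j+2+t-1) (solve (t ∷ j ∷ []))
  , ≤-by-slack (+ 1 + (t + t)) (+-mono-≤ (0≤+ 1) (+-mono-≤ 0≤t 0≤t)) (solve (t ∷ j ∷ [])) )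
  where
  0≤j+2+t-1 : + 0 ≤ j + + 2 + t - + 1
  0≤j+2+t-1 = i≤j⇒0≤j-i (i<j⇒suc[i]≤j (≰⇒> j+2+t≰0))

odd-difference⇒odd-sum : ∀ {i j} y → i - j ≡ + 1 + (y + y) → + 0 ≤ i + j → OddSumOrEvenGap i j
odd-difference⇒odd-sum {i} {j} y i-j≡1+2y 0≤i+j = inj₁ (∣ y + j ∣ , (begin
  i                                              ≡⟨ solve (i ∷ j ∷ []) ⟩
  i - j + j                                      ≡⟨ cong (_+ j) i-j≡1+2y ⟩
  + 1 + (y + y) + j                              ≡⟨ solve (y ∷ j ∷ []) ⟩
  + 1 + ((y + j) + (y + j)) - j                  ≡⟨ cong (λ z → + 1 + (z + z) - j) (sym (0≤i⇒+∣i∣≡i 0≤y+j)) ⟩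
  + 1 + (+ ∣ y + j ∣ + + ∣ y + j ∣) - j          ∎))
  where
  open ≡-Reasoning
  i+j≡1+2[y+j] : i + j ≡ + 1 + ((y + j) + (y + j))
  i+j≡1+2[y+j] = begin
    i + j               ≡⟨ solve (i ∷ j ∷ []) ⟩
    i - j + (j + j)     ≡⟨ cong (_+ (j + j)) i-j≡1+2y ⟩
    + 1 + (y + y) + (j + j) ≡⟨ solve (y ∷ j ∷ []) ⟩
    + 1 + ((y + j) + (y + j)) ∎
  0≤y+j : + 0 ≤ y + j
  0≤y+j = 0≤1+[y+y]⇒0≤y (y + j) (subst (+ 0 ≤_) i+j≡1+2[y+j] 0≤i+j)

even-difference⇒even-gap : ∀ {i j} y → i - j ≡ y + y → + 1 ≤ y + y → OddSumOrEvenGap i j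
even-difference⇒even-gap {i} {j} (+ suc t) i-j≡2y _ = inj₂ (t , (begin
  i                          ≡⟨ solve (i ∷ j ∷ []) ⟩
  i - j + j                  ≡⟨ cong (_+ j) i-j≡2y ⟩
  + suc t + + suc t + j      ≡⟨ regroup j (+ t) ⟩
  j + + 2 + (+ t + + t)      ∎))
  where
  open ≡-Reasoning
  regroup : ∀ j t → (+ 1 + t) + (+ 1 + t) + j ≡ j + + 2 + (t + t)
  regroup = solve-∀
even-difference⇒even-gap (+ zero) _ (+≤+ ())
even-difference⇒even-gap -[1+ n ] _ ()

conditions⇒odd-sum-or-even-gap : ∀ {i j} → Conditions i j → OddSumOrEvenGap i j
conditions⇒odd-sum-or-even-gap {i} {j} c with even-or-odd (i - j) | c
... | inj₁ (y , i-j≡2y) | inj₁ (_ , _ , j≤i-1) =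
  even-difference⇒even-gap {i} {j} y i-j≡2y (subst (+ 1 ≤_) i-j≡2y
    (≤-by-slack (i - + 1 - j) (i≤j⇒0≤j-i j≤i-1) (solve (i ∷ j ∷ []))))
... | inj₂ (y , i-j≡1+2y) | inj₁ (_ , -i≤j , _) =
  odd-difference⇒odd-sum {i} {j} y i-j≡1+2y (≤-by-slack (j - - i) (i≤j⇒0≤j-i -i≤j) (solve (i ∷ j ∷ [])))
... | inj₁ (y , i-j≡2y) | inj₂ (inj₁ (_ , _ , _ , 2∤i-j)) =
  ⊥-elim (2∤i-j (subst (+ 2 ∣_) (sym i-j≡2y) (2∣y+y y)))
... | inj₂ (y , i-j≡1+2y) | inj₂ (inj₁ (_ , 1-j≤i , _ , _)) =
  odd-difference⇒odd-sum {i} {j} y i-j≡1+2y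
    (≤-by-slack (i - (+ 1 - j) + + 1) (+-mono-≤ (i≤j⇒0≤j-i 1-j≤i) (0≤+ 1)) (solve (i ∷ j ∷ [])))
... | inj₁ (y , i-j≡2y) | inj₂ (inj₂ (_ , j+2≤i , _ , _)) =
  even-difference⇒even-gap {i} {j} y i-j≡2y (subst (+ 1 ≤_) i-j≡2y
    (≤-by-slack (i - (j + + 2) + + 1) (+-mono-≤ (i≤j⇒0≤j-i j+2≤i) (0≤+ 1)) (solve (i ∷ j ∷ []))))
... | inj₂ (y , i-j≡1+2y) | inj₂ (inj₂ (_ , _ , _ , 2∣i-j)) =
  ⊥-elim (2∤1+[y+y] y (subst (+ 2 ∣_) i-j≡1+2y 2∣i-j))

odd-sum-or-even-gap⇒conditions : ∀ {i j} → OddSumOrEvenGap i j → Conditions i j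
odd-sum-or-even-gap⇒conditions (inj₁ (t , refl)) = odd-sum-conditions (+ t) _ (0≤+ t)
odd-sum-or-even-gap⇒conditions (inj₂ (t , refl)) = even-gap-conditions (+ t) _ (0≤+ t)

theorem5 : (i j : ℤ) →
    (Σ ℕ λ n → s n ≡ i × s (ℕ.suc n) ≡ j)
    ⇔
    ((+ 0 < i × - i ≤ j × j ≤ i - + 1)
     ⊎ (+ 1 ≤ j × + 1 - j ≤ i × i ≤ j + + 1 × ¬ (+ 2 ∣ i - j))
     ⊎ (j ≤ - + 2 × j + + 2 ≤ i × i ≤ - j - + 2 × + 2 ∣ i - j))
theorem5 i j = mk⇔ realised⇒conditions conditions⇒realised
  where
  realised⇒conditions : (Σ ℕ λ n → s n ≡ i × s (suc n) ≡ j) → Conditions i j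
  realised⇒conditions (n , refl , refl) =
    odd-sum-or-even-gap⇒conditions (consecutive⇒odd-sum-or-even-gap (s-consecutive n))
  conditions⇒realised : Conditions i j → Σ ℕ λ n → s n ≡ i × s (suc n) ≡ j
  conditions⇒realised c =
    consecutive-realised (odd-sum-or-even-gap⇒consecutive (conditions⇒odd-sum-or-even-gap c))
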